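{- Let $m\ge 1$ and $t>2$ be integers, and let $G=G_{m,1}$ be the path graph on $m$ vertices. Then \[\gamma_{t,2}(G) \le \left\lfloor \frac{(m+2(t-2))(1+2(t-2))}{2(t-1)^2}\right\rfloor .\]
   Context: $G_{m,1}$ is the graph with vertex set $\{0,1,\dots,m-1\}$ and edges between $i$ and $i+1$. For a graph $G=(V,E)$ and positive integers $t,r$, a tower vertex $T\in V$ supplies to a vertex $v\in V$ the signal $sig(T,v)=\max(t-dist(T,v),0)$, where $dist$ is the graph (shortest-path) distance. A $(t,r)$ broadcast on $G$ is a set $\mathbb{T}\subseteq V$ such that for every $v\in V$, $\sum_{T\in\mathbb{T}} sig(T,v)\ge r$. The $(t,r)$ broadcast domination number $\gamma_{t,r}(G)$ is the minimum cardinality of a $(t,r)$ broadcast on $G$. -}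

module Defs where

open import Data.Nat using (ℕ; zero; suc; _+_; _*_; _∸_; _≥_; ∣_-_∣)
open import Data.Fin using (Fin; toℕ)
open import Data.Fin.Subset using (Subset; inside; outside)
open import Data.Vec using (lookup)
open import Data.Vec.Functional using () renaming (foldr to vfoldr)
open import Data.Product using (Σ; _×_)
open import Data.Nat using (_≤_)
open import Data.Fin.Subset using (∣_∣)

-- The path graph G_{m,1}: vertices Fin m, edges {i, i+1}.
-- Its shortest-path distance is dist(i,j) = |i - j|.
pathDist : {m : ℕ} → Fin m → Fin m → ℕ
pathDist i j = ∣ toℕ i - toℕ j ∣

sig : {m : ℕ} → (t : ℕ) → Fin m → Fin m → ℕ
sig t T v = t ∸ pathDist T v

contrib : {m : ℕ} → (t : ℕ) → Subset m → Fin m → Fin m → ℕ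
contrib t S v T with lookup S T
... | inside  = sig t T v
... | outside = 0

totalSig : {m : ℕ} → (t : ℕ) → Subset m → Fin m → ℕ
totalSig {m} t S v = vfoldr _+_ 0 (contrib t S v)

IsBroadcast : (m t r : ℕ) → Subset m → Set
IsBroadcast m t r S = (v : Fin m) → totalSig t S v ≥ r

γ≤ : (m t r k : ℕ) → Set
γ≤ m t r k = Σ (Subset m) λ S → IsBroadcast m t r S × ∣ S ∣ ≤ k

{-# OPTIONS --safe #-}
module Submission where

open import Defs
open import Data.Nat using (ℕ; _+_; _*_; _∸_; _≤_; _<_; _/_; NonZero)
open import Data.Nat.Base using (zero; suc; z≤n; s≤s; s≤s⁻¹; _⊓_; ∣_-_∣)
open import Data.Nat.Properties
open import Data.Nat.DivMod using (_%_; m≡m%n+[m/n]*n; m%n<n; m/n*n≤m; m*n/n≡m; /-monoˡ-≤)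
open import Data.Nat.Tactic.RingSolver using (solve-∀)
open import Data.Fin using (Fin; toℕ; fromℕ<) renaming (zero to fzero; suc to fsuc)
open import Data.Fin.Properties using (toℕ-fromℕ<; toℕ<n)
open import Data.Fin.Subset using (Subset; inside; outside; ⊥; ⁅_⁆; _∪_; _∈_; ∣_∣)
open import Data.Fin.Subset.Properties using (∣⊥∣≡0; ∣⁅x⁆∣≡1; x∈⁅x⁆; x∈p∪q⁺)
open import Data.Vec using ([]; _∷_)
open import Data.Vec.Properties using ([]=⇒lookup)
open import Data.Vec.Functional using () renaming (foldr to vfoldr)
open import Data.Product using (_,_)
open import Data.Sum using (inj₁; inj₂)
open import Function using (_∘_)
open import Relation.Nullary using (yes; no; contradiction)
open import Relation.Binary.PropositionalEquality

-- Put towers N = 2(t-1) apart, at the vertices j N + (t-2), moving a tower that falls off the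
-- path to the last vertex. A tower supplies signal at least 2 to the 2t-3 vertices within
-- distance t-2 of it; the one remaining vertex of each period is at distance t-1 from two
-- consecutive towers and receives 1 + 1. So k = ⌊m/N⌋ + 1 towers form a (t,2) broadcast, and
-- k · 2(t-1)² ≤ (m + 2(t-2))(2t-3) is elementary arithmetic once m ≥ 1 and t ≥ 3.

f≤sum : ∀ {n} (f : Fin n → ℕ) i → f i ≤ vfoldr _+_ 0 f
f≤sum f fzero    = m≤m+n _ _
f≤sum f (fsuc i) = ≤-trans (f≤sum (f ∘ fsuc) i) (m≤n+m _ _)

f+f≤sum : ∀ {n} (f : Fin n → ℕ) {i j} → i ≢ j → f i + f j ≤ vfoldr _+_ 0 f
f+f≤sum f {fzero}  {fzero}  i≢j = contradiction refl i≢j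
f+f≤sum f {fzero}  {fsuc j} _   = +-monoʳ-≤ (f fzero) (f≤sum (f ∘ fsuc) j)
f+f≤sum f {fsuc i} {fzero}  i≢j =
  ≤-trans (≤-reflexive (+-comm (f (fsuc i)) (f fzero))) (f+f≤sum f (i≢j ∘ sym))
f+f≤sum f {fsuc i} {fsuc j} i≢j = ≤-trans (f+f≤sum (f ∘ fsuc) (i≢j ∘ cong fsuc)) (m≤n+m _ _)

∣p∪q∣≤∣p∣+∣q∣ : ∀ {n} (p q : Subset n) → ∣ p ∪ q ∣ ≤ ∣ p ∣ + ∣ q ∣
∣p∪q∣≤∣p∣+∣q∣ []            []            = z≤n
∣p∪q∣≤∣p∣+∣q∣ (inside  ∷ p) (inside  ∷ q) =
  s≤s (≤-trans (∣p∪q∣≤∣p∣+∣q∣ p q) (+-monoʳ-≤ ∣ p ∣ (n≤1+n ∣ q ∣)))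
∣p∪q∣≤∣p∣+∣q∣ (inside  ∷ p) (outside ∷ q) = s≤s (∣p∪q∣≤∣p∣+∣q∣ p q)
∣p∪q∣≤∣p∣+∣q∣ (outside ∷ p) (inside  ∷ q) =
  ≤-trans (s≤s (∣p∪q∣≤∣p∣+∣q∣ p q)) (≤-reflexive (sym (+-suc ∣ p ∣ ∣ q ∣)))
∣p∪q∣≤∣p∣+∣q∣ (outside ∷ p) (outside ∷ q) = ∣p∪q∣≤∣p∣+∣q∣ p q

∣m-n∣≤o : ∀ {m n o} → m ≤ n + o → n ≤ m + o → ∣ m - n ∣ ≤ o
∣m-n∣≤o {m} {n} m≤n+o n≤m+o with ≤-total m n
... | inj₁ m≤n = subst (_≤ _) (sym (m≤n⇒∣m-n∣≡n∸m m≤n)) (m≤n+o⇒m∸n≤o n m n≤m+o)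
... | inj₂ n≤m = subst (_≤ _) (sym (m≤n⇒∣n-m∣≡n∸m n≤m)) (m≤n+o⇒m∸n≤o m n m≤n+o)

∣m⊓o-n∣≤∣m-n∣ : ∀ m {n o} → n ≤ o → ∣ m ⊓ o - n ∣ ≤ ∣ m - n ∣
∣m⊓o-n∣≤∣m-n∣ m {n} {o} n≤o with ≤-total m o
... | inj₁ m≤o rewrite m≤n⇒m⊓n≡m m≤o = ≤-refl
... | inj₂ o≤m rewrite m≥n⇒m⊓n≡n o≤m | m≤n⇒∣n-m∣≡n∸m n≤o | m≤n⇒∣n-m∣≡n∸m (≤-trans n≤o o≤m) =
  ∸-monoˡ-≤ n o≤m

m<[1+m/n]*n : ∀ m n .{{_ : NonZero n}} → m < suc (m / n) * n
m<[1+m/n]*n m n = begin-strict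
  m                 ≡⟨ m≡m%n+[m/n]*n m n ⟩
  m % n + m / n * n <⟨ +-monoˡ-< (m / n * n) (m%n<n m n) ⟩
  n + m / n * n     ∎
  where open ≤-Reasoning

[1+m/n]*n≤n+m : ∀ m n .{{_ : NonZero n}} → suc (m / n) * n ≤ n + m
[1+m/n]*n≤n+m m n = +-monoʳ-≤ n (m/n*n≤m m n)

m*n≤o⇒m≤o/n : ∀ {m n o} .{{_ : NonZero n}} → m * n ≤ o → m ≤ o / n
m*n≤o⇒m≤o/n {m} {n} {o} m*n≤o = subst (_≤ o / n) (m*n/n≡m m n) (/-monoˡ-≤ n m*n≤o)

module _ {m : ℕ} (t : ℕ) {S : Subset m} {T : Fin m} (v : Fin m) where

  contrib-∈ : T ∈ S → contrib t S v T ≡ sig t T v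
  contrib-∈ T∈S rewrite []=⇒lookup T∈S = refl

  sig≤totalSig : T ∈ S → sig t T v ≤ totalSig t S v
  sig≤totalSig T∈S = subst (_≤ totalSig t S v) (contrib-∈ T∈S) (f≤sum (contrib t S v) T)

sig+sig≤totalSig : ∀ {m} t {S : Subset m} {T T′} v → T ∈ S → T′ ∈ S → T ≢ T′ →
                   sig t T v + sig t T′ v ≤ totalSig t S v
sig+sig≤totalSig t {S} v T∈S T′∈S T≢T′ =
  subst₂ (λ x y → x + y ≤ totalSig t S v) (contrib-∈ t v T∈S) (contrib-∈ t v T′∈S)
    (f+f≤sum (contrib t S v) T≢T′)

module _ {m ρ : ℕ} (T v : Fin m) where

  2≤sig : pathDist T v ≤ ρ → 2 ≤ sig (2 + ρ) T v
  2≤sig d≤ρ = subst (_≤ sig (2 + ρ) T v) (m+n∸n≡m 2 ρ) (∸-monoʳ-≤ (2 + ρ) d≤ρ)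

  1≤sig : pathDist T v ≤ suc ρ → 1 ≤ sig (2 + ρ) T v
  1≤sig d≤1+ρ = subst (_≤ sig (2 + ρ) T v) (m+n∸n≡m 1 ρ) (∸-monoʳ-≤ (2 + ρ) d≤1+ρ)

clamp : ∀ {n} → ℕ → Fin (suc n)
clamp {n} c = fromℕ< (s≤s (m⊓n≤n c n))

toℕ-clamp : ∀ {n} c → toℕ (clamp {n} c) ≡ c ⊓ n
toℕ-clamp {n} c = toℕ-fromℕ< (s≤s (m⊓n≤n c n))

pathDist-clamp : ∀ {n} c (v : Fin (suc n)) → pathDist (clamp c) v ≤ ∣ c - toℕ v ∣
pathDist-clamp c v =
  subst (λ x → ∣ x - toℕ v ∣ ≤ ∣ c - toℕ v ∣) (sym (toℕ-clamp c)) (∣m⊓o-n∣≤∣m-n∣ c (s≤s⁻¹ (toℕ<n v)))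

-- ρ = t - 2 is the distance within which a tower supplies signal 2; the path has n + 1 vertices.
module SpacedTowers (ρ n : ℕ) where

  period : ℕ
  period = suc ρ + suc ρ

  centre : ℕ → ℕ
  centre j = j * period + ρ

  tower : ℕ → Fin (suc n)
  tower j = clamp (centre j)

  towers : ℕ → Subset (suc n)
  towers zero    = ⊥
  towers (suc k) = ⁅ tower k ⁆ ∪ towers k

  ∣towers∣≤ : ∀ k → ∣ towers k ∣ ≤ k
  ∣towers∣≤ zero    = ≤-reflexive (∣⊥∣≡0 (suc n))
  ∣towers∣≤ (suc k) = begin
    ∣ ⁅ tower k ⁆ ∪ towers k ∣     ≤⟨ ∣p∪q∣≤∣p∣+∣q∣ ⁅ tower k ⁆ (towers k) ⟩
    ∣ ⁅ tower k ⁆ ∣ + ∣ towers k ∣ ≡⟨ cong (_+ ∣ towers k ∣) (∣⁅x⁆∣≡1 (tower k)) ⟩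
    suc ∣ towers k ∣               ≤⟨ s≤s (∣towers∣≤ k) ⟩
    suc k                          ∎
    where open ≤-Reasoning

  tower∈towers : ∀ {j k} → j < k → tower j ∈ towers k
  tower∈towers {j} {suc k} j<1+k with m<1+n⇒m<n∨m≡n j<1+k
  ... | inj₁ j<k  = x∈p∪q⁺ (inj₂ (tower∈towers j<k))
  ... | inj₂ refl = x∈p∪q⁺ (inj₁ (x∈⁅x⁆ (tower j)))

  next-centre : ∀ j → centre (suc j) ≡ centre j + suc ρ + suc ρ
  next-centre j = shift ρ (j * period)
    where
    shift : ∀ ρ Q → suc ρ + suc ρ + Q + ρ ≡ Q + ρ + suc ρ + suc ρ
    shift = solve-∀

  next-block : ∀ j → suc j * period ≡ suc (centre j + suc ρ)
  next-block j = shift ρ (j * period)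
    where
    shift : ∀ ρ Q → suc ρ + suc ρ + Q ≡ suc (Q + ρ + suc ρ)
    shift = solve-∀

  module _ (k : ℕ) (enough : suc (suc n) ≤ k * period) (v : Fin (suc n)) (q : ℕ) where

    private
      v≤n : toℕ v ≤ n
      v≤n = s≤s⁻¹ (toℕ<n v)

      index< : ∀ {j} → j * period ≤ suc n → j < k
      index< {j} j*P≤1+n = *-cancelʳ-< period j k (≤-<-trans j*P≤1+n enough)

    covered-near : ∀ {r} → toℕ v ≡ q * period + r → r ≤ ρ + ρ → 2 ≤ totalSig (2 + ρ) (towers k) v
    covered-near {r} v≡ r≤2ρ =
      ≤-trans (2≤sig (tower q) v dist≤ρ) (sig≤totalSig (2 + ρ) v (tower∈towers q<k))
      where
      q<k : q < k
      q<k = index< (≤-trans (m≤m+n (q * period) r) (≤-trans (≤-reflexive (sym v≡)) (m≤n⇒m≤1+n v≤n)))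
      dist≤ρ : pathDist (tower q) v ≤ ρ
      dist≤ρ = ≤-trans (pathDist-clamp (centre q) v)
        (subst (λ x → ∣ centre q - x ∣ ≤ ρ) (sym v≡)
          (subst (_≤ ρ) (sym (∣m+n-m+o∣≡∣n-o∣ (q * period) ρ r)) (∣m-n∣≤o (m≤n+m ρ r) r≤2ρ)))

    covered-between : toℕ v ≡ centre q + suc ρ → 2 ≤ totalSig (2 + ρ) (towers k) v
    covered-between v≡ =
      ≤-trans (+-mono-≤ (1≤sig (tower q) v dist-left) (1≤sig (tower (suc q)) v dist-right))
        (sig+sig≤totalSig (2 + ρ) v (tower∈towers (<-trans (n<1+n q) 1+q<k)) (tower∈towers 1+q<k)
          distinct)
      where
      next≡ : centre (suc q) ≡ toℕ v + suc ρ
      next≡ = trans (next-centre q) (cong (_+ suc ρ) (sym v≡))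
      1+q<k : suc q < k
      1+q<k = index< (subst (_≤ suc n) (sym (trans (next-block q) (cong suc (sym v≡)))) (s≤s v≤n))
      dist-left : pathDist (tower q) v ≤ suc ρ
      dist-left = ≤-trans (pathDist-clamp (centre q) v)
        (≤-reflexive (trans (cong (∣ centre q -_∣) v≡) (∣m-m+n∣≡n (centre q) (suc ρ))))
      dist-right : pathDist (tower (suc q)) v ≤ suc ρ
      dist-right = ≤-trans (pathDist-clamp (centre (suc q)) v)
        (≤-reflexive (trans (cong (∣_- toℕ v ∣) next≡)
          (trans (∣-∣-comm (toℕ v + suc ρ) (toℕ v)) (∣m-m+n∣≡n (toℕ v) (suc ρ)))))
      distinct : tower q ≢ tower (suc q)
      distinct eq = <-irrefl (cong toℕ eq) (begin-strict
        toℕ (tower q)        ≡⟨ toℕ-clamp (centre q) ⟩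
        centre q ⊓ n         ≤⟨ m⊓n≤m (centre q) n ⟩
        centre q             <⟨ subst (centre q <_) (sym v≡) (m<m+n (centre q) (s≤s z≤n)) ⟩
        toℕ v                ≤⟨ ⊓-glb (subst (toℕ v ≤_) (sym next≡) (m≤m+n (toℕ v) (suc ρ))) v≤n ⟩
        centre (suc q) ⊓ n   ≡⟨ sym (toℕ-clamp (centre (suc q))) ⟩
        toℕ (tower (suc q))  ∎)
        where open ≤-Reasoning

    covered : ∀ {r} → toℕ v ≡ q * period + r → r < period → 2 ≤ totalSig (2 + ρ) (towers k) v
    covered {r} v≡ r<P with r ≤? ρ + ρ
    ... | yes r≤2ρ = covered-near v≡ r≤2ρ
    ... | no  r≰2ρ = covered-between (begin
      toℕ v                    ≡⟨ v≡ ⟩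
      q * period + r           ≡⟨ cong (q * period +_) r≡ ⟩
      q * period + suc (ρ + ρ) ≡⟨ cong (q * period +_) (sym (+-suc ρ ρ)) ⟩
      q * period + (ρ + suc ρ) ≡⟨ sym (+-assoc (q * period) ρ (suc ρ)) ⟩
      centre q + suc ρ         ∎)
      where
      open ≡-Reasoning
      r≡ : r ≡ suc (ρ + ρ)
      r≡ = ≤-antisym (≤-trans (s≤s⁻¹ r<P) (≤-reflexive (+-suc ρ ρ))) (≰⇒> r≰2ρ)

  towers-broadcast : ∀ k → suc (suc n) ≤ k * period → IsBroadcast (suc n) (2 + ρ) 2 (towers k)
  towers-broadcast k enough v =
    covered k enough v (toℕ v / period)
      (trans (m≡m%n+[m/n]*n (toℕ v) period) (+-comm (toℕ v % period) _)) (m%n<n (toℕ v) period)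

tower-count-bound : ∀ {ρ m k} → 1 ≤ ρ → 1 ≤ m → k * (suc ρ + suc ρ) ≤ (suc ρ + suc ρ) + m →
                    k * (2 * (suc ρ * suc ρ)) ≤ (m + 2 * ρ) * (1 + 2 * ρ)
tower-count-bound {suc a} {1} {k} _ _ kP≤P+1 = begin
  k * (2 * (suc ρ * suc ρ))                           ≤⟨ *-monoˡ-≤ (2 * (suc ρ * suc ρ)) k≤1 ⟩
  1 * (2 * (suc ρ * suc ρ))                           ≤⟨ m≤m+n _ (2 * a * a + 4 * a + 1) ⟩
  1 * (2 * (suc ρ * suc ρ)) + (2 * a * a + 4 * a + 1) ≡⟨ slack a ⟩
  (1 + 2 * ρ) * (1 + 2 * ρ)                           ∎
  where
  open ≤-Reasoning
  ρ = suc a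
  k≤1 : k ≤ 1
  k≤1 = s≤s⁻¹ (*-cancelʳ-< (suc ρ + suc ρ) k 2
          (≤-<-trans kP≤P+1 (+-monoʳ-< (suc ρ + suc ρ) (s≤s (s≤s z≤n)))))
  slack : ∀ a → 1 * (2 * ((2 + a) * (2 + a))) + (2 * a * a + 4 * a + 1)
                ≡ (1 + 2 * (1 + a)) * (1 + 2 * (1 + a))
  slack = solve-∀
tower-count-bound {suc a} {suc (suc b)} {k} _ _ kP≤P+m = begin
  k * (2 * (suc ρ * suc ρ))                                     ≡⟨ regroup k a ⟩
  k * (suc ρ + suc ρ) * suc ρ                                   ≤⟨ *-monoˡ-≤ (suc ρ) kP≤P+m ⟩
  (suc ρ + suc ρ + m) * suc ρ                                   ≤⟨ m≤m+n _ (2 * a * a + a * b + 4 * a + b) ⟩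
  (suc ρ + suc ρ + m) * suc ρ + (2 * a * a + a * b + 4 * a + b) ≡⟨ slack a b ⟩
  (m + 2 * ρ) * (1 + 2 * ρ)                                     ∎
  where
  open ≤-Reasoning
  ρ = suc a
  m = suc (suc b)
  regroup : ∀ k a → k * (2 * ((2 + a) * (2 + a))) ≡ k * ((2 + a) + (2 + a)) * (2 + a)
  regroup = solve-∀
  slack : ∀ a b → ((2 + a) + (2 + a) + (2 + b)) * (2 + a) + (2 * a * a + a * b + 4 * a + b)
                  ≡ (2 + b + 2 * (1 + a)) * (1 + 2 * (1 + a))
  slack = solve-∀

lemma4 : (m t : ℕ) → 1 ≤ m → 2 < t → .⦃ _ : NonZero (2 * ((t ∸ 1) * (t ∸ 1))) ⦄ →
    γ≤ m t 2 (((m + 2 * (t ∸ 2)) * (1 + 2 * (t ∸ 2))) / (2 * ((t ∸ 1) * (t ∸ 1))))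
lemma4 (suc n) _ _ (s≤s (s≤s (s≤s {n = a} z≤n))) =
  towers k , towers-broadcast k (m<[1+m/n]*n (suc n) period) ,
  ≤-trans (∣towers∣≤ k)
    (m*n≤o⇒m≤o/n (tower-count-bound {k = k} (s≤s z≤n) (s≤s z≤n) ([1+m/n]*n≤n+m (suc n) period)))
  where
  open SpacedTowers (suc a) n
  k = suc (suc n / period)
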